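{- For every integer $k\ge1$, the Beneš network of order $k$ is a balancer.
   Context: A splitter network is a finite directed graph $G$ with arc set $E$ whose vertex set is partitioned as $I\uplus S\uplus O$, where each input has out-degree $1$ and in-degree $0$, each output has in-degree $1$ and out-degree $0$, and each splitter has in-degree $2$ and out-degree $2$. $\delta^+(v),\delta^-(v)$ denote outgoing/incoming arcs; $\delta^-(O)$ is the set of arcs entering outputs. A capacity function is $c:I\cup O\to[0,1]$. A steady-state for $(G,c)$ is a pair $(t,F)$ with $t:E\to[0,1]$ and $F\subseteq E$ (fluid arcs; $E\setminus F$ saturated) such that: (R3) for each input $i$ with $\delta^+(i)=\{e\}$, $t(e)\le c(i)$, and if $e\in F$ then $t(e)=c(i)$; (R4) for each output $o$ with $\delta^-(o)=\{e\}$, $t(e)\le c(o)$, and if $e\notin F$ then $t(e)=c(o)$; (R5) for each splitter $s$, $t(\delta^-(s))=t(\delta^+(s))$; (R6) for each splitter $s$ with $\delta^-(s)=\{e_1,e_2\}$ and $e_1\notin F$, $t(e_1)\ge t(e_2)$; (R7) for each splitter $s$ with $\delta^+(s)=\{e_1,e_2\}$ and $e_1\in F$, $t(e_1)\ge t(e_2)$; (R8) for arcs $uv\in E\setminus F$, $vw\in F$, $t(uv)=1$ or $t(vw)=1$. A splitter network is a balancer if for every $c$ with $c(o)=1$ for all outputs $o$ there is a steady-state $(t,F)$ with $t$ constant on $\delta^-(O)$. The Beneš network of order $k$ has inputs $i_j$ and outputs $o_j$ for $j\in\{0,\dots,2^k-1\}$, splitters $s_{(l,j)}$ for $l\in\{0,\dots,2k-2\}$,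 $j\in\{0,\dots,2^{k-1}-1\}$, arcs $i_js_{(0,\lfloor j/2\rfloor)}$ and $s_{(2k-2,\lfloor j/2\rfloor)}o_j$ for $j\in\{0,\dots,2^k-1\}$, and for each $l\in\{0,\dots,2k-3\}$ and $j\in\{0,\dots,2^{k-1}-1\}$ the arcs $s_{(l,j)}s_{(l+1,j)}$ and $s_{(l,j)}s_{(l+1,j\oplus2^{l'})}$, where $l'=\max\{k-2-l,\ l-k+1\}$ and $\oplus$ is bitwise exclusive or.
   Formalization: The capacity function c takes only rational values in $[0,1]$, and the steady-state arc values t are likewise taken in the rationals. -}

module Defs where

open import Data.Nat as ℕ using (ℕ; zero; suc; _∸_; _⊔_; _^_; s≤s; z≤n)
open import Data.Nat.Properties using (m^n≢0)
open import Data.Nat.DivMod using (_mod_)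
open import Data.Fin as Fin using (Fin; toℕ; inject₁; fromℕ)
open import Data.Rational using (ℚ; 0ℚ; 1ℚ; _≤_; _+_)
open import Data.Bool using (Bool; true; false)
open import Data.Product using (Σ; ∃; ∃₂; _×_; _,_)
open import Data.Sum using (_⊎_)
open import Relation.Binary.PropositionalEquality using (_≡_; _≢_)

data Vertex (I S O : Set) : Set where
  inp : I → Vertex I S O
  spl : S → Vertex I S O
  out : O → Vertex I S O

record Network : Set₁ where
  field
    Inp Spl Out Arc : Set
    tail head : Arc → Vertex Inp Spl Out

Finite : Set → Set
Finite A = Σ ℕ λ n → Σ (Fin n → A) λ f → ∀ a → ∃ λ i → f i ≡ a

module _ (G : Network) where
  open Network G

  V : Set
  V = Vertex Inp Spl Out

  OutDeg0 InDeg0 OutDeg1 InDeg1 OutDeg2 InDeg2 : V → Set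
  OutDeg0 v = ∀ e → tail e ≢ v
  InDeg0 v = ∀ e → head e ≢ v
  OutDeg1 v = ∃ λ e → tail e ≡ v × (∀ e' → tail e' ≡ v → e' ≡ e)
  InDeg1 v = ∃ λ e → head e ≡ v × (∀ e' → head e' ≡ v → e' ≡ e)
  OutDeg2 v = ∃₂ λ e₁ e₂ → e₁ ≢ e₂ × tail e₁ ≡ v × tail e₂ ≡ v
                × (∀ e → tail e ≡ v → e ≡ e₁ ⊎ e ≡ e₂)
  InDeg2 v = ∃₂ λ e₁ e₂ → e₁ ≢ e₂ × head e₁ ≡ v × head e₂ ≡ v
                × (∀ e → head e ≡ v → e ≡ e₁ ⊎ e ≡ e₂)

  IsSplitterNetwork : Set
  IsSplitterNetwork =
    Finite V × Finite Arc
    × (∀ i → OutDeg1 (inp i) × InDeg0 (inp i))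
    × (∀ o → InDeg1 (out o) × OutDeg0 (out o))
    × (∀ s → InDeg2 (spl s) × OutDeg2 (spl s))

  -- steady-state (t , F) for capacities cI (inputs), cO (outputs);
  -- e ∈ F  iff  F e ≡ true  (fluid);  F e ≡ false means saturated
  SteadyState : (Inp → ℚ) → (Out → ℚ) → (Arc → ℚ) → (Arc → Bool) → Set
  SteadyState cI cO t F =
    (∀ e → 0ℚ ≤ t e × t e ≤ 1ℚ)
    × (∀ i e → tail e ≡ inp i → t e ≤ cI i × (F e ≡ true → t e ≡ cI i))
    × (∀ o e → head e ≡ out o → t e ≤ cO o × (F e ≡ false → t e ≡ cO o))
    × (∀ s e₁ e₂ f₁ f₂ → e₁ ≢ e₂ → head e₁ ≡ spl s → head e₂ ≡ spl s
         → f₁ ≢ f₂ → tail f₁ ≡ spl s → tail f₂ ≡ spl s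
         → t e₁ + t e₂ ≡ t f₁ + t f₂)
    × (∀ s e₁ e₂ → e₁ ≢ e₂ → head e₁ ≡ spl s → head e₂ ≡ spl s
         → F e₁ ≡ false → t e₂ ≤ t e₁)
    × (∀ s e₁ e₂ → e₁ ≢ e₂ → tail e₁ ≡ spl s → tail e₂ ≡ spl s
         → F e₁ ≡ true → t e₂ ≤ t e₁)
    × (∀ e e' → head e ≡ tail e' → F e ≡ false → F e' ≡ true
         → t e ≡ 1ℚ ⊎ t e' ≡ 1ℚ)

  IsBalancer : Set
  IsBalancer =
    ∀ (cI : Inp → ℚ) (cO : Out → ℚ)
    → (∀ i → 0ℚ ≤ cI i × cI i ≤ 1ℚ)
    → (∀ o → cO o ≡ 1ℚ)
    → ∃₂ λ (t : Arc → ℚ) (F : Arc → Bool) → SteadyState cI cO t F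
        × ∃ λ (r : ℚ) → ∀ e o → head e ≡ out o → t e ≡ r

-- bitwise exclusive or on ℕ (fuel-based; fuel a + b suffices)

bitXor : ℕ → ℕ → ℕ
bitXor a b = (a ℕ.% 2 ℕ.+ b ℕ.% 2) ℕ.% 2

xorF : ℕ → ℕ → ℕ → ℕ
xorF zero a b = 0
xorF (suc f) a b = bitXor a b ℕ.+ 2 ℕ.* xorF f (a ℕ./ 2) (b ℕ./ 2)

_⊕_ : ℕ → ℕ → ℕ
a ⊕ b = xorF (a ℕ.+ b) a b

-- Beneš network of order k = suc m.
-- inputs/outputs j ∈ {0..2^k-1}; splitters (l , j), l ∈ {0..2k-2}
-- (Fin (suc (2 * m))), j ∈ {0..2^(k-1)-1} (Fin (2 ^ m)).

data BenesArc (m : ℕ) : Set where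
  inArc  : Fin (2 ^ suc m) → BenesArc m
  outArc : Fin (2 ^ suc m) → BenesArc m
  straightArc : Fin (2 ℕ.* m) → Fin (2 ^ m) → BenesArc m
  crossArc    : Fin (2 ℕ.* m) → Fin (2 ^ m) → BenesArc m

module BenesDef (m : ℕ) where
  -- reduce a natural number into Fin (2 ^ m) (identity on the values used)
  toRow : ℕ → Fin (2 ^ m)
  toRow x = _mod_ x (2 ^ m) {{m^n≢0 2 m}}

  half : Fin (2 ^ suc m) → Fin (2 ^ m)
  half j = toRow (toℕ j ℕ./ 2)

  -- l' = max {k-2-l , l-k+1} with k = suc m
  l′ : ℕ → ℕ
  l′ l = (m ∸ suc l) ⊔ (l ∸ m)

  Sp : Set
  Sp = Fin (suc (2 ℕ.* m)) × Fin (2 ^ m)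

  VB : Set
  VB = Vertex (Fin (2 ^ suc m)) Sp (Fin (2 ^ suc m))

  tailB headB : BenesArc m → VB
  tailB (inArc j) = inp j
  tailB (outArc j) = spl (fromℕ (2 ℕ.* m) , half j)
  tailB (straightArc l j) = spl (inject₁ l , j)
  tailB (crossArc l j) = spl (inject₁ l , j)
  headB (inArc j) = spl (Fin.zero , half j)
  headB (outArc j) = out j
  headB (straightArc l j) = spl (Fin.suc l , j)
  headB (crossArc l j) = spl (Fin.suc l , toRow (toℕ j ⊕ (2 ^ l′ (toℕ l))))

  network : Network
  network = record
    { Inp = Fin (2 ^ suc m) ; Spl = Sp ; Out = Fin (2 ^ suc m)
    ; Arc = BenesArc m ; tail = tailB ; head = headB }

Benes : (k : ℕ) → 1 ℕ.≤ k → Network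
Benes (suc m) _ = BenesDef.network m

{-# OPTIONS --safe #-}
-- Make every arc fluid and let every splitter send the average of its two inflows along
-- both outflows. Conservation (R5) is then the averaging itself, (R7) holds because both
-- outflows are equal, (R6) and (R8) are vacuous, and no arc exceeds the output capacity 1.
--
-- In the Beneš network of order k = m + 1 the value leaving splitter (l, j) is level l j,
-- where level (l + 1) j averages level l at j and at j with bit l′(l) flipped. For l < m
-- that bit is m - 1 - l, so by induction level l j depends only on the m - l lowest bits
-- of j. Hence level m is constant, averaging keeps it constant through the remaining
-- layers, and all outputs carry the same value (the mean of the input capacities).
module Submission where

open import Defs
open import Data.Nat using (ℕ; _≤_)
open import Data.Product using (_×_)

open import Data.Bool using (true; false)
open import Data.Empty using (⊥-elim)
open import Data.Fin as Fin using (Fin; toℕ; fromℕ; fromℕ<; inject₁)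
open import Data.Fin.Properties
  using ( toℕ-fromℕ; toℕ-fromℕ<; toℕ-injective; toℕ<n; toℕ-inject₁; inject₁-injective
        ; fromℕ≢inject₁; +↔⊎; *↔×)
open import Data.Fin.Relation.Unary.Top using (view; ‵fromℕ; ‵inject₁)
open import Data.Nat
  using ( zero; suc; _+_; _*_; _∸_; _^_; _<_; _%_; _/_; _⊔_; NonZero
        ; _≤′_; ≤′-refl; ≤′-step; z≤n; s≤s; z<s; s<s)
open import Data.Nat.DivMod
open import Data.Nat.Properties
open import Data.Product using (∃₂; _,_; proj₂; uncurry)
open import Data.Product.Properties using (,-injectiveˡ; ,-injectiveʳ)
import Data.Product as Product
open import Data.Rational as ℚ using (ℚ; 0ℚ; 1ℚ; ½)
import Data.Rational.Properties as ℚ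
open import Data.Sum as Sum using (_⊎_; inj₁; inj₂; [_,_]′)
open import Data.Unit using (⊤; tt)
open import Function using (_∘_; _↔_; Inverse)
open import Function.Definitions using (StrictlySurjective)
open import Relation.Binary.PropositionalEquality
open import Relation.Nullary using (yes; no)

open ≡-Reasoning

-- Binary digits

m≡m%2+2*[m/2] : ∀ a → a ≡ a % 2 + 2 * (a / 2)
m≡m%2+2*[m/2] a = trans (m≡m%n+[m/n]*n a 2) (cong (a % 2 +_) (*-comm (a / 2) 2))

[r+2q]%2≡r : ∀ {r} → r < 2 → ∀ q → (r + 2 * q) % 2 ≡ r
[r+2q]%2≡r {r} r<2 q = begin
  (r + 2 * q) % 2 ≡⟨ cong (λ x → (r + x) % 2) (*-comm 2 q) ⟩
  (r + q * 2) % 2 ≡⟨ [m+kn]%n≡m%n r q 2 ⟩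
  r % 2           ≡⟨ m<n⇒m%n≡m r<2 ⟩
  r               ∎

[r+2q]/2≡q : ∀ {r} → r < 2 → ∀ q → (r + 2 * q) / 2 ≡ q
[r+2q]/2≡q {r} r<2 q = begin
  (r + 2 * q) / 2   ≡⟨ cong (λ x → (r + x) / 2) (*-comm 2 q) ⟩
  (r + q * 2) / 2   ≡⟨ +-distrib-/ r (q * 2) no-carry ⟩
  r / 2 + q * 2 / 2 ≡⟨ cong₂ _+_ (m<n⇒m/n≡0 r<2) (m*n/n≡m q 2) ⟩
  q                 ∎
  where
  no-carry : r % 2 + (q * 2) % 2 < 2
  no-carry = subst (_< 2) (sym (trans (cong₂ _+_ (m<n⇒m%n≡m r<2) (m*n%n≡0 q 2)) (+-identityʳ r))) r<2

≡-by-digits : ∀ {a b} → a % 2 ≡ b % 2 → a / 2 ≡ b / 2 → a ≡ b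
≡-by-digits {a} {b} a%2≡b%2 a/2≡b/2 = begin
  a                   ≡⟨ m≡m%2+2*[m/2] a ⟩
  a % 2 + 2 * (a / 2) ≡⟨ cong₂ (λ r q → r + 2 * q) a%2≡b%2 a/2≡b/2 ⟩
  b % 2 + 2 * (b / 2) ≡⟨ m≡m%2+2*[m/2] b ⟨
  b                   ∎

r+2q<2n : ∀ {r q n} → r < 2 → q < n → r + 2 * q < 2 * n
r+2q<2n {0} _ q<n = *-monoʳ-< 2 q<n
r+2q<2n {1} {q} {n} _ q<n = subst (_≤ 2 * n) (cong suc (+-suc q (q + 0))) (*-monoʳ-≤ 2 q<n)
r+2q<2n {suc (suc _)} (s≤s (s≤s ())) _

m<2n⇒m/2<n : ∀ {a n} → a < 2 * n → a / 2 < n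
m<2n⇒m/2<n {a} {n} a<2n = m<n*o⇒m/o<n (subst (a <_) (*-comm 2 n) a<2n)

m≤1+n⇒m/2≤n : ∀ {a n} → a ≤ suc n → a / 2 ≤ n
m≤1+n⇒m/2≤n {a} {n} a≤1+n = ≤-trans (/-monoˡ-≤ 2 a≤1+n) (<⇒≤pred (m/n<m (suc n) 2 (s≤s (s≤s z≤n))))

p<2^p : ∀ p → p < 2 ^ p
p<2^p zero = s≤s z≤n
p<2^p (suc p) = subst (suc (suc p) ≤_) (cong (2 ^ p +_) (sym (+-identityʳ (2 ^ p))))
  (+-mono-≤ (m^n>0 2 p) (p<2^p p))

m%2≡0⊎m%2≡1 : ∀ a → a % 2 ≡ 0 ⊎ a % 2 ≡ 1
m%2≡0⊎m%2≡1 a with a % 2 | m%n<n a 2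
... | 0 | _ = inj₁ refl
... | 1 | _ = inj₂ refl
... | suc (suc _) | s≤s (s≤s ())

1∸r<2 : ∀ r → 1 ∸ r < 2
1∸r<2 r = s≤s (m∸n≤m 1 r)

1∸[1∸r]≡r : ∀ {r} → r < 2 → 1 ∸ (1 ∸ r) ≡ r
1∸[1∸r]≡r {0} _ = refl
1∸[1∸r]≡r {1} _ = refl
1∸[1∸r]≡r {suc (suc _)} (s≤s (s≤s ()))

[r+1]%2≡1∸r : ∀ {r} → r < 2 → (r + 1) % 2 ≡ 1 ∸ r
[r+1]%2≡1∸r {0} _ = refl
[r+1]%2≡1∸r {1} _ = refl
[r+1]%2≡1∸r {suc (suc _)} (s≤s (s≤s ()))

r≢s⇒r≡1∸s : ∀ {r s} → r < 2 → s < 2 → r ≢ s → r ≡ 1 ∸ s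
r≢s⇒r≡1∸s {0} {0} _ _ r≢s = ⊥-elim (r≢s refl)
r≢s⇒r≡1∸s {0} {1} _ _ _ = refl
r≢s⇒r≡1∸s {1} {0} _ _ _ = refl
r≢s⇒r≡1∸s {1} {1} _ _ r≢s = ⊥-elim (r≢s refl)
r≢s⇒r≡1∸s {suc (suc _)} (s≤s (s≤s ())) _ _
r≢s⇒r≡1∸s {_} {suc (suc _)} _ (s≤s (s≤s ())) _

flipBit : ℕ → ℕ → ℕ
flipBit zero a = (1 ∸ a % 2) + 2 * (a / 2)
flipBit (suc p) a = a % 2 + 2 * flipBit p (a / 2)

flipBit-zero-%2 : ∀ a → flipBit zero a % 2 ≡ 1 ∸ a % 2
flipBit-zero-%2 a = [r+2q]%2≡r (1∸r<2 (a % 2)) (a / 2)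

flipBit-zero-/2 : ∀ a → flipBit zero a / 2 ≡ a / 2
flipBit-zero-/2 a = [r+2q]/2≡q (1∸r<2 (a % 2)) (a / 2)

flipBit-suc-%2 : ∀ p a → flipBit (suc p) a % 2 ≡ a % 2
flipBit-suc-%2 p a = [r+2q]%2≡r (m%n<n a 2) (flipBit p (a / 2))

flipBit-suc-/2 : ∀ p a → flipBit (suc p) a / 2 ≡ flipBit p (a / 2)
flipBit-suc-/2 p a = [r+2q]/2≡q (m%n<n a 2) (flipBit p (a / 2))

flipBit-involutive : ∀ p a → flipBit p (flipBit p a) ≡ a
flipBit-involutive zero a = ≡-by-digits
  (begin
    flipBit zero (flipBit zero a) % 2 ≡⟨ flipBit-zero-%2 (flipBit zero a) ⟩
    1 ∸ flipBit zero a % 2            ≡⟨ cong (1 ∸_) (flipBit-zero-%2 a) ⟩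
    1 ∸ (1 ∸ a % 2)                   ≡⟨ 1∸[1∸r]≡r (m%n<n a 2) ⟩
    a % 2                             ∎)
  (trans (flipBit-zero-/2 (flipBit zero a)) (flipBit-zero-/2 a))
flipBit-involutive (suc p) a = ≡-by-digits
  (trans (flipBit-suc-%2 p (flipBit (suc p) a)) (flipBit-suc-%2 p a))
  (begin
    flipBit (suc p) (flipBit (suc p) a) / 2 ≡⟨ flipBit-suc-/2 p (flipBit (suc p) a) ⟩
    flipBit p (flipBit (suc p) a / 2)       ≡⟨ cong (flipBit p) (flipBit-suc-/2 p a) ⟩
    flipBit p (flipBit p (a / 2))           ≡⟨ flipBit-involutive p (a / 2) ⟩
    a / 2                                   ∎)

flipBit-< : ∀ {p n a} → p < n → a < 2 ^ n → flipBit p a < 2 ^ n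
flipBit-< {zero} {suc n} {a} _ a<2^n = r+2q<2n (1∸r<2 (a % 2)) (m<2n⇒m/2<n {n = 2 ^ n} a<2^n)
flipBit-< {suc p} {suc n} {a} (s≤s p<n) a<2^n =
  r+2q<2n (m%n<n a 2) (flipBit-< p<n (m<2n⇒m/2<n {n = 2 ^ n} a<2^n))

xorF-zero : ∀ f {a} → a ≤ f → xorF f a 0 ≡ a
xorF-zero zero z≤n = refl
xorF-zero (suc f) {a} a≤1+f = begin
  (a % 2 + 0) % 2 + 2 * xorF f (a / 2) 0 ≡⟨ cong₂ _+_ low high ⟩
  a % 2 + 2 * (a / 2)                     ≡⟨ m≡m%2+2*[m/2] a ⟨
  a                                       ∎
  where
  low : (a % 2 + 0) % 2 ≡ a % 2
  low = trans (cong (_% 2) (+-identityʳ (a % 2))) (m%n%n≡m%n a 2)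
  high : 2 * xorF f (a / 2) 0 ≡ 2 * (a / 2)
  high = cong (2 *_) (xorF-zero f (m≤1+n⇒m/2≤n a≤1+f))

xorF-2^ : ∀ p f {a} → a ≤ f → p < f → xorF f a (2 ^ p) ≡ flipBit p a
xorF-2^ zero (suc f) {a} a≤1+f _ =
  cong₂ _+_ ([r+1]%2≡1∸r (m%n<n a 2)) (cong (2 *_) (xorF-zero f (m≤1+n⇒m/2≤n a≤1+f)))
xorF-2^ (suc p) (suc f) {a} a≤1+f (s≤s p<f) = cong₂ _+_ low high
  where
  low : (a % 2 + (2 * 2 ^ p) % 2) % 2 ≡ a % 2
  low = begin
    (a % 2 + (2 * 2 ^ p) % 2) % 2 ≡⟨ cong (λ x → (a % 2 + x) % 2) ([r+2q]%2≡r (s≤s z≤n) (2 ^ p)) ⟩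
    (a % 2 + 0) % 2               ≡⟨ cong (_% 2) (+-identityʳ (a % 2)) ⟩
    a % 2 % 2                     ≡⟨ m%n%n≡m%n a 2 ⟩
    a % 2                         ∎
  high : 2 * xorF f (a / 2) ((2 * 2 ^ p) / 2) ≡ 2 * flipBit p (a / 2)
  high = cong (2 *_) (trans (cong (xorF f (a / 2)) ([r+2q]/2≡q (s≤s z≤n) (2 ^ p)))
                            (xorF-2^ p f (m≤1+n⇒m/2≤n a≤1+f) p<f))

⊕-2^ : ∀ p a → a ⊕ (2 ^ p) ≡ flipBit p a
⊕-2^ p a = xorF-2^ p (a + 2 ^ p) (m≤m+n a (2 ^ p)) (≤-trans (p<2^p p) (m≤n+m (2 ^ p) a))

SameLowBits : ℕ → ℕ → ℕ → Set
SameLowBits zero a b = ⊤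
SameLowBits (suc n) a b = a % 2 ≡ b % 2 × SameLowBits n (a / 2) (b / 2)

sameLowBits⇒≡ : ∀ n {a b} → a < 2 ^ n → b < 2 ^ n → SameLowBits n a b → a ≡ b
sameLowBits⇒≡ zero a<1 b<1 _ = trans (n<1⇒n≡0 a<1) (sym (n<1⇒n≡0 b<1))
sameLowBits⇒≡ (suc n) a<2^n b<2^n (a%2≡b%2 , rest) =
  ≡-by-digits a%2≡b%2 (sameLowBits⇒≡ n (m<2n⇒m/2<n a<2^n) (m<2n⇒m/2<n b<2^n) rest)

sameLowBits-extend : ∀ n {a b} → SameLowBits n a b
  → SameLowBits (suc n) a b ⊎ SameLowBits (suc n) a (flipBit n b)
sameLowBits-extend zero {a} {b} _ with a % 2 ≟ b % 2
... | yes a%2≡b%2 = inj₁ (a%2≡b%2 , tt)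
... | no a%2≢b%2 =
  inj₂ (trans (r≢s⇒r≡1∸s (m%n<n a 2) (m%n<n b 2) a%2≢b%2) (sym (flipBit-zero-%2 b)) , tt)
sameLowBits-extend (suc n) {a} {b} (a%2≡b%2 , rest) with sameLowBits-extend n rest
... | inj₁ same = inj₁ (a%2≡b%2 , same)
... | inj₂ flipped = inj₂ (trans a%2≡b%2 (sym (flipBit-suc-%2 n b)) ,
                           subst (SameLowBits (suc n) (a / 2)) (sym (flipBit-suc-/2 n b)) flipped)

sameLowBits-flipBit : ∀ n {a b} → SameLowBits (suc n) a b
  → SameLowBits (suc n) (flipBit n a) (flipBit n b)
sameLowBits-flipBit zero {a} {b} (a%2≡b%2 , _) =
  trans (flipBit-zero-%2 a) (trans (cong (1 ∸_) a%2≡b%2) (sym (flipBit-zero-%2 b))) , tt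
sameLowBits-flipBit (suc n) {a} {b} (a%2≡b%2 , rest) =
  trans (flipBit-suc-%2 n a) (trans a%2≡b%2 (sym (flipBit-suc-%2 n b))) ,
  subst₂ (SameLowBits (suc n)) (sym (flipBit-suc-/2 n a)) (sym (flipBit-suc-/2 n b))
         (sameLowBits-flipBit n rest)

-- Averages of rationals in the unit interval

InUnitInterval : ℚ → Set
InUnitInterval x = 0ℚ ℚ.≤ x × x ℚ.≤ 1ℚ

avg : ℚ → ℚ → ℚ
avg x y = ½ ℚ.* (x ℚ.+ y)

avg+avg≡+ : ∀ x y → avg x y ℚ.+ avg x y ≡ x ℚ.+ y
avg+avg≡+ x y = begin
  ½ ℚ.* (x ℚ.+ y) ℚ.+ ½ ℚ.* (x ℚ.+ y) ≡⟨ ℚ.*-distribʳ-+ (x ℚ.+ y) ½ ½ ⟨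
  1ℚ ℚ.* (x ℚ.+ y)                   ≡⟨ ℚ.*-identityˡ (x ℚ.+ y) ⟩
  x ℚ.+ y                            ∎

avg-comm : ∀ x y → avg x y ≡ avg y x
avg-comm x y = cong (½ ℚ.*_) (ℚ.+-comm x y)

avg-inUnitInterval : ∀ {x y} → InUnitInterval x → InUnitInterval y → InUnitInterval (avg x y)
avg-inUnitInterval (0≤x , x≤1) (0≤y , y≤1) =
  ℚ.*-monoˡ-≤-nonNeg ½ (ℚ.+-mono-≤ 0≤x 0≤y) , ℚ.*-monoˡ-≤-nonNeg ½ (ℚ.+-mono-≤ x≤1 y≤1)

-- Finite types

Finite-↔ : ∀ {n A} → Fin n ↔ A → Finite A
Finite-↔ {n} Fin↔A = n , to , λ a → from a , strictlyInverseˡ a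
  where open Inverse Fin↔A

Finite-surjection : ∀ {A B : Set} → Finite A → (f : A → B) → StrictlySurjective _≡_ f → Finite B
Finite-surjection (n , enum , enum-onto) f f-onto = n , f ∘ enum , λ b →
  let a , fa≡b = f-onto b ; i , enum-i≡a = enum-onto a in i , trans (cong f enum-i≡a) fa≡b

Finite-Fin : ∀ n → Finite (Fin n)
Finite-Fin n = n , (λ i → i) , λ i → i , refl

Finite-⊎ : ∀ {A B : Set} → Finite A → Finite B → Finite (A ⊎ B)
Finite-⊎ (_ , enumA , ontoA) (_ , enumB , ontoB) =
  Finite-surjection (Finite-↔ +↔⊎) (Sum.map enumA enumB) λ where
    (inj₁ a) → Product.map inj₁ (cong inj₁) (ontoA a)
    (inj₂ b) → Product.map inj₂ (cong inj₂) (ontoB b)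

Finite-× : ∀ {A B : Set} → Finite A → Finite B → Finite (A × B)
Finite-× (_ , enumA , ontoA) (_ , enumB , ontoB) =
  Finite-surjection (Finite-↔ *↔×) (Product.map enumA enumB) λ (a , b) →
    let i , enum-i≡a = ontoA a ; j , enum-j≡b = ontoB b in (i , j) , cong₂ _,_ enum-i≡a enum-j≡b

Finite-Vertex : ∀ {I S O : Set} → Finite I → Finite S → Finite O → Finite (Vertex I S O)
Finite-Vertex finI finS finO =
  Finite-surjection (Finite-⊎ finI (Finite-⊎ finS finO)) [ inp , [ spl , out ]′ ]′ λ where
    (inp i) → inj₁ i , refl
    (spl s) → inj₂ (inj₁ s) , refl
    (out o) → inj₂ (inj₂ o) , refl

spl-injective : ∀ {I S O : Set} {s s′ : S} → spl {I} {S} {O} s ≡ spl s′ → s ≡ s′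
spl-injective refl = refl

-- Steady states in which every splitter halves its inflow

module _ (G : Network) where
  open Network G

  AveragesInflow : (V G → ℚ) → Set
  AveragesInflow τ = ∀ s → ∃₂ λ a b → (∀ e → head e ≡ spl s → e ≡ a ⊎ e ≡ b)
                                     × τ (tail a) ℚ.+ τ (tail b) ≡ τ (spl s) ℚ.+ τ (spl s)

  private
    sum-over-pair : ∀ (t : Arc → ℚ) {a b e₁ e₂} → e₁ ≢ e₂
      → e₁ ≡ a ⊎ e₁ ≡ b → e₂ ≡ a ⊎ e₂ ≡ b → t e₁ ℚ.+ t e₂ ≡ t a ℚ.+ t b
    sum-over-pair t e₁≢e₂ (inj₁ refl) (inj₁ refl) = ⊥-elim (e₁≢e₂ refl)
    sum-over-pair t _     (inj₁ refl) (inj₂ refl) = refl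
    sum-over-pair t {a} {b} _ (inj₂ refl) (inj₁ refl) = ℚ.+-comm (t b) (t a)
    sum-over-pair t e₁≢e₂ (inj₂ refl) (inj₂ refl) = ⊥-elim (e₁≢e₂ refl)

  averaging-steadyState : ∀ {cI cO} (τ : V G → ℚ) → (∀ v → InUnitInterval (τ v))
    → (∀ i → τ (inp i) ≡ cI i) → (∀ o → cO o ≡ 1ℚ) → AveragesInflow τ
    → SteadyState G cI cO (τ ∘ tail) (λ _ → true)
  averaging-steadyState {cI} {cO} τ τ∈[0,1] τ-inp cO≡1 averages =
    (τ∈[0,1] ∘ tail) , R3 , R4 , R5 , (λ _ _ _ _ _ _ ()) , R7 , (λ _ _ _ ())
    where
    t : Arc → ℚ
    t = τ ∘ tail

    R3 : ∀ i e → tail e ≡ inp i → t e ℚ.≤ cI i × (true ≡ true → t e ≡ cI i)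
    R3 i e tail≡i = ℚ.≤-reflexive t≡c , λ _ → t≡c
      where
      t≡c : t e ≡ cI i
      t≡c = trans (cong τ tail≡i) (τ-inp i)

    R4 : ∀ o e → head e ≡ out o → t e ℚ.≤ cO o × (true ≡ false → t e ≡ cO o)
    R4 o e _ = subst (t e ℚ.≤_) (sym (cO≡1 o)) (proj₂ (τ∈[0,1] (tail e))) , λ ()

    R5 : ∀ s e₁ e₂ f₁ f₂ → e₁ ≢ e₂ → head e₁ ≡ spl s → head e₂ ≡ spl s
       → f₁ ≢ f₂ → tail f₁ ≡ spl s → tail f₂ ≡ spl s → t e₁ ℚ.+ t e₂ ≡ t f₁ ℚ.+ t f₂
    R5 s e₁ e₂ f₁ f₂ e₁≢e₂ e₁↦s e₂↦s _ s↦f₁ s↦f₂ with averages s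
    ... | a , b , into , inflow = begin
      t e₁ ℚ.+ t e₂             ≡⟨ sum-over-pair t e₁≢e₂ (into e₁ e₁↦s) (into e₂ e₂↦s) ⟩
      t a ℚ.+ t b               ≡⟨ inflow ⟩
      τ (spl s) ℚ.+ τ (spl s)   ≡⟨ cong₂ ℚ._+_ (cong τ s↦f₁) (cong τ s↦f₂) ⟨
      t f₁ ℚ.+ t f₂             ∎

    R7 : ∀ s e₁ e₂ → e₁ ≢ e₂ → tail e₁ ≡ spl s → tail e₂ ≡ spl s → true ≡ true → t e₂ ℚ.≤ t e₁
    R7 s e₁ e₂ _ s↦e₁ s↦e₂ _ = ℚ.≤-reflexive (cong τ (trans s↦e₂ (sym s↦e₁)))

-- The Beneš network

l′<k : ∀ k {l} → l < 2 * k → BenesDef.l′ k l < k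
l′<k (suc k) {l} l<2k = ⊔-lub (s≤s (m∸n≤m k l))
  (m<n+o⇒m∸n<o l (suc k) (subst (l <_) (cong (suc k +_) (+-identityʳ (suc k))) l<2k))

l′-below : ∀ {k l n} → suc l + n ≡ k → BenesDef.l′ k l ≡ n
l′-below {l = l} {n} refl = begin
  (suc l + n ∸ suc l) ⊔ (l ∸ suc (l + n)) ≡⟨ cong₂ _⊔_ (m+n∸m≡n (suc l) n) (m≤n⇒m∸n≡0 l≤1+l+n) ⟩
  n ⊔ 0                                   ≡⟨ ⊔-identityʳ n ⟩
  n                                       ∎
  where
  l≤1+l+n : l ≤ suc (l + n)
  l≤1+l+n = m≤n⇒m≤1+n (m≤m+n l n)

module BenesNetwork (m : ℕ) where
  open BenesDef m

  instance
    2^m≢0 : NonZero (2 ^ m)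
    2^m≢0 = m^n≢0 2 m

  toℕ-toRow : ∀ {x} → x < 2 ^ m → toℕ (toRow x) ≡ x
  toℕ-toRow x<2^m = trans (toℕ-fromℕ< _) (m<n⇒m%n≡m x<2^m)

  toRow-toℕ : ∀ j → toRow (toℕ j) ≡ j
  toRow-toℕ j = toℕ-injective (toℕ-toRow (toℕ<n j))

  port : ∀ {r} → r < 2 → Fin (2 ^ m) → Fin (2 ^ suc m)
  port {r} r<2 j = fromℕ< {r + 2 * toℕ j} (r+2q<2n r<2 (toℕ<n j))

  port₀ port₁ : Fin (2 ^ m) → Fin (2 ^ suc m)
  port₀ = port z<s
  port₁ = port (s<s z<s)

  toℕ-port : ∀ {r} (r<2 : r < 2) j → toℕ (port r<2 j) ≡ r + 2 * toℕ j
  toℕ-port r<2 j = toℕ-fromℕ< (r+2q<2n r<2 (toℕ<n j))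

  half-port : ∀ {r} (r<2 : r < 2) j → half (port r<2 j) ≡ j
  half-port {r} r<2 j = begin
    toRow (toℕ (port r<2 j) / 2) ≡⟨ cong (λ x → toRow (x / 2)) (toℕ-port r<2 j) ⟩
    toRow ((r + 2 * toℕ j) / 2)  ≡⟨ cong toRow ([r+2q]/2≡q r<2 (toℕ j)) ⟩
    toRow (toℕ j)                ≡⟨ toRow-toℕ j ⟩
    j                            ∎

  port₀≢port₁ : ∀ j → port₀ j ≢ port₁ j
  port₀≢port₁ j port₀≡port₁ = 0≢1+n (begin
    0                   ≡⟨ [r+2q]%2≡r z<s (toℕ j) ⟨
    (0 + 2 * toℕ j) % 2 ≡⟨ cong (_% 2) (toℕ-port z<s j) ⟨
    toℕ (port₀ j) % 2   ≡⟨ cong (λ i → toℕ i % 2) port₀≡port₁ ⟩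
    toℕ (port₁ j) % 2   ≡⟨ cong (_% 2) (toℕ-port (s<s z<s) j) ⟩
    (1 + 2 * toℕ j) % 2 ≡⟨ [r+2q]%2≡r (s<s z<s) (toℕ j) ⟩
    1                   ∎)

  toℕ-half : ∀ i → toℕ (half i) ≡ toℕ i / 2
  toℕ-half i = toℕ-toRow (m<2n⇒m/2<n {n = 2 ^ m} (toℕ<n i))

  port-half : ∀ i → i ≡ port₀ (half i) ⊎ i ≡ port₁ (half i)
  port-half i = Sum.map (as-port z<s) (as-port (s<s z<s)) (m%2≡0⊎m%2≡1 (toℕ i))
    where
    as-port : ∀ {r} (r<2 : r < 2) → toℕ i % 2 ≡ r → i ≡ port r<2 (half i)
    as-port {r} r<2 bit≡r = toℕ-injective (begin
      toℕ i                         ≡⟨ m≡m%2+2*[m/2] (toℕ i) ⟩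
      toℕ i % 2 + 2 * (toℕ i / 2)   ≡⟨ cong₂ (λ x y → x + 2 * y) bit≡r (sym (toℕ-half i)) ⟩
      r + 2 * toℕ (half i)          ≡⟨ toℕ-port r<2 (half i) ⟨
      toℕ (port r<2 (half i))       ∎)

  flipRow : ℕ → Fin (2 ^ m) → Fin (2 ^ m)
  flipRow p j = toRow (flipBit p (toℕ j))

  toℕ-flipRow : ∀ {p} → p < m → ∀ j → toℕ (flipRow p j) ≡ flipBit p (toℕ j)
  toℕ-flipRow p<m j = toℕ-toRow (flipBit-< p<m (toℕ<n j))

  flipRow-involutive : ∀ {p} → p < m → ∀ j → flipRow p (flipRow p j) ≡ j
  flipRow-involutive {p} p<m j = toℕ-injective (begin
    toℕ (flipRow p (flipRow p j)) ≡⟨ toℕ-flipRow p<m (flipRow p j) ⟩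
    flipBit p (toℕ (flipRow p j)) ≡⟨ cong (flipBit p) (toℕ-flipRow p<m j) ⟩
    flipBit p (flipBit p (toℕ j)) ≡⟨ flipBit-involutive p (toℕ j) ⟩
    toℕ j                         ∎)

  flipRow-sameLowBits : ∀ {n} → n < m → ∀ {a b} → SameLowBits (suc n) (toℕ a) (toℕ b)
    → SameLowBits (suc n) (toℕ (flipRow n a)) (toℕ (flipRow n b))
  flipRow-sameLowBits {n} n<m {a} {b} same = subst₂ (SameLowBits (suc n))
    (sym (toℕ-flipRow n<m a)) (sym (toℕ-flipRow n<m b)) (sameLowBits-flipBit n same)

  cross : Fin (2 * m) → Fin (2 ^ m) → Fin (2 ^ m)
  cross l = flipRow (l′ (toℕ l))

  cross-involutive : ∀ l j → cross l (cross l j) ≡ j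
  cross-involutive l = flipRow-involutive (l′<k m (toℕ<n l))

  head-crossArc : ∀ l j → headB (crossArc l j) ≡ spl (Fin.suc l , cross l j)
  head-crossArc l j = cong (λ x → spl (Fin.suc l , toRow x)) (⊕-2^ (l′ (toℕ l)) (toℕ j))

  inArc-injective : ∀ {i i′} → inArc {m} i ≡ inArc i′ → i ≡ i′
  inArc-injective refl = refl

  outArc-injective : ∀ {o o′} → outArc {m} o ≡ outArc o′ → o ≡ o′
  outArc-injective refl = refl

  in₁ in₂ : Sp → BenesArc m
  in₁ (Fin.zero , j) = inArc (port₀ j)
  in₁ (Fin.suc l , j) = straightArc l j
  in₂ (Fin.zero , j) = inArc (port₁ j)
  in₂ (Fin.suc l , j) = crossArc l (cross l j)

  in₁≢in₂ : ∀ s → in₁ s ≢ in₂ s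
  in₁≢in₂ (Fin.zero , j) in₁≡in₂ = port₀≢port₁ j (inArc-injective in₁≡in₂)
  in₁≢in₂ (Fin.suc l , j) ()

  head-in₁ : ∀ s → headB (in₁ s) ≡ spl s
  head-in₁ (Fin.zero , j) = cong (λ x → spl (Fin.zero , x)) (half-port z<s j)
  head-in₁ (Fin.suc l , j) = refl

  head-in₂ : ∀ s → headB (in₂ s) ≡ spl s
  head-in₂ (Fin.zero , j) = cong (λ x → spl (Fin.zero , x)) (half-port (s<s z<s) j)
  head-in₂ (Fin.suc l , j) =
    trans (head-crossArc l (cross l j)) (cong (λ x → spl (Fin.suc l , x)) (cross-involutive l j))

  incoming : ∀ s e → headB e ≡ spl s → e ≡ in₁ s ⊎ e ≡ in₂ s
  incoming (Fin.zero , j) (inArc i) e↦s with spl-injective e↦s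
  ... | refl = Sum.map (cong inArc) (cong inArc) (port-half i)
  incoming (Fin.suc l , j) (straightArc l′ j′) e↦s with spl-injective e↦s
  ... | refl = inj₁ refl
  incoming (Fin.suc l , j) (crossArc l′ j′) e↦s
    with spl-injective (trans (sym (head-crossArc l′ j′)) e↦s)
  ... | refl = inj₂ (cong (crossArc l′) (sym (cross-involutive l′ j′)))

  outgoing : ∀ l j → OutDeg2 network (spl (l , j))
  outgoing l j with view l
  ... | ‵fromℕ = outArc (port₀ j) , outArc (port₁ j) , (port₀≢port₁ j ∘ outArc-injective)
      , cong (λ x → spl (fromℕ (2 * m) , x)) (half-port z<s j)
      , cong (λ x → spl (fromℕ (2 * m) , x)) (half-port (s<s z<s) j) , from-last
    where
    from-last : ∀ e → tailB e ≡ spl (fromℕ (2 * m) , j) → e ≡ outArc (port₀ j) ⊎ e ≡ outArc (port₁ j)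
    from-last (outArc i) s↦e with spl-injective s↦e
    ... | refl = Sum.map (cong outArc) (cong outArc) (port-half i)
    from-last (straightArc _ _) s↦e = ⊥-elim (fromℕ≢inject₁ (sym (,-injectiveˡ (spl-injective s↦e))))
    from-last (crossArc _ _) s↦e = ⊥-elim (fromℕ≢inject₁ (sym (,-injectiveˡ (spl-injective s↦e))))
  ... | ‵inject₁ l′ = straightArc l′ j , crossArc l′ j , (λ ()) , refl , refl , from-inner
    where
    from-inner : ∀ e → tailB e ≡ spl (inject₁ l′ , j) → e ≡ straightArc l′ j ⊎ e ≡ crossArc l′ j
    from-inner (outArc _) s↦e = ⊥-elim (fromℕ≢inject₁ (,-injectiveˡ (spl-injective s↦e)))
    from-inner (straightArc _ _) s↦e = inj₁ (cong₂ straightArc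
      (inject₁-injective (,-injectiveˡ (spl-injective s↦e))) (,-injectiveʳ (spl-injective s↦e)))
    from-inner (crossArc _ _) s↦e = inj₂ (cong₂ crossArc
      (inject₁-injective (,-injectiveˡ (spl-injective s↦e))) (,-injectiveʳ (spl-injective s↦e)))

  isSplitterNetwork : IsSplitterNetwork network
  isSplitterNetwork = finite-vertices , finite-arcs , inputs , outputs , splitters
    where
    finite-vertices : Finite VB
    finite-vertices = Finite-Vertex (Finite-Fin _) (Finite-× (Finite-Fin _) (Finite-Fin _)) (Finite-Fin _)

    finite-arcs : Finite (BenesArc m)
    finite-arcs = Finite-surjection
      (Finite-⊎ (Finite-⊎ (Finite-Fin _) (Finite-Fin _))
                (Finite-⊎ (Finite-× (Finite-Fin _) (Finite-Fin _)) (Finite-× (Finite-Fin _) (Finite-Fin _))))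
      [ [ inArc , outArc ]′ , [ uncurry straightArc , uncurry crossArc ]′ ]′ λ where
        (inArc i) → inj₁ (inj₁ i) , refl
        (outArc o) → inj₁ (inj₂ o) , refl
        (straightArc l j) → inj₂ (inj₁ (l , j)) , refl
        (crossArc l j) → inj₂ (inj₂ (l , j)) , refl

    inputs : ∀ i → OutDeg1 network (inp i) × InDeg0 network (inp i)
    inputs i = (inArc i , refl , λ { (inArc _) refl → refl })
             , λ { (inArc _) () ; (outArc _) () ; (straightArc _ _) () ; (crossArc _ _) () }

    outputs : ∀ o → InDeg1 network (out o) × OutDeg0 network (out o)
    outputs o = (outArc o , refl , λ { (outArc _) refl → refl })
              , λ { (inArc _) () ; (outArc _) () ; (straightArc _ _) () ; (crossArc _ _) () }

    splitters : ∀ s → InDeg2 network (spl s) × OutDeg2 network (spl s)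
    splitters s@(l , j) = (in₁ s , in₂ s , in₁≢in₂ s , head-in₁ s , head-in₂ s , incoming s)
                        , outgoing l j

  module _ (cI : Fin (2 ^ suc m) → ℚ) where

    level : ℕ → Fin (2 ^ m) → ℚ
    level zero j = avg (cI (port₀ j)) (cI (port₁ j))
    level (suc l) j = avg (level l j) (level l (flipRow (l′ l) j))

    level-sameLowBits : ∀ l {n} → l + n ≡ m → ∀ {a b} → SameLowBits n (toℕ a) (toℕ b)
      → level l a ≡ level l b
    level-sameLowBits zero refl {a} {b} same =
      cong (level zero) (toℕ-injective (sameLowBits⇒≡ m (toℕ<n a) (toℕ<n b) same))
    level-sameLowBits (suc l) {n} 1+l+n≡m {a} {b} same =
      subst (λ p → avg (level l a) (level l (flipRow p a)) ≡ avg (level l b) (level l (flipRow p b)))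
            (sym (l′-below 1+l+n≡m)) (by-bit-n (sameLowBits-extend n same))
      where
      n<m : n < m
      n<m = subst (n <_) 1+l+n≡m (m<n+m n z<s)

      level-l : ∀ {a b} → SameLowBits (suc n) (toℕ a) (toℕ b) → level l a ≡ level l b
      level-l = level-sameLowBits l (trans (+-suc l n) 1+l+n≡m)

      by-bit-n : SameLowBits (suc n) (toℕ a) (toℕ b) ⊎ SameLowBits (suc n) (toℕ a) (flipBit n (toℕ b))
        → avg (level l a) (level l (flipRow n a)) ≡ avg (level l b) (level l (flipRow n b))
      by-bit-n (inj₁ same) = cong₂ avg (level-l same) (level-l (flipRow-sameLowBits n<m same))
      by-bit-n (inj₂ opposite) = begin
        avg (level l a) (level l (flipRow n a))
          ≡⟨ cong₂ avg (level-l opposite′) (level-l (flipRow-sameLowBits n<m opposite′)) ⟩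
        avg (level l (flipRow n b)) (level l (flipRow n (flipRow n b)))
          ≡⟨ cong (λ x → avg (level l (flipRow n b)) (level l x)) (flipRow-involutive n<m b) ⟩
        avg (level l (flipRow n b)) (level l b)
          ≡⟨ avg-comm (level l (flipRow n b)) (level l b) ⟩
        avg (level l b) (level l (flipRow n b))
          ∎
        where
        opposite′ : SameLowBits (suc n) (toℕ a) (toℕ (flipRow n b))
        opposite′ = subst (SameLowBits (suc n) (toℕ a)) (sym (toℕ-flipRow n<m b)) opposite

    level-uniform : ∀ {l} → m ≤′ l → ∀ a b → level l a ≡ level l b
    level-uniform ≤′-refl a b = level-sameLowBits m (+-identityʳ m) tt
    level-uniform (≤′-step m≤′l) a b =
      cong₂ avg (level-uniform m≤′l a b) (level-uniform m≤′l (flipRow (l′ _) a) (flipRow (l′ _) b))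

    level-inUnitInterval : (∀ i → InUnitInterval (cI i)) → ∀ l j → InUnitInterval (level l j)
    level-inUnitInterval cI∈[0,1] zero j = avg-inUnitInterval (cI∈[0,1] (port₀ j)) (cI∈[0,1] (port₁ j))
    level-inUnitInterval cI∈[0,1] (suc l) j =
      avg-inUnitInterval (level-inUnitInterval cI∈[0,1] l j) (level-inUnitInterval cI∈[0,1] l _)

    -- Outputs are never tails of arcs, so the value 0ℚ there is never used.
    τ : VB → ℚ
    τ (inp i) = cI i
    τ (spl (l , j)) = level (toℕ l) j
    τ (out _) = 0ℚ

    τ-inUnitInterval : (∀ i → InUnitInterval (cI i)) → ∀ v → InUnitInterval (τ v)
    τ-inUnitInterval cI∈[0,1] (inp i) = cI∈[0,1] i
    τ-inUnitInterval cI∈[0,1] (spl (l , j)) = level-inUnitInterval cI∈[0,1] (toℕ l) j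
    τ-inUnitInterval cI∈[0,1] (out _) = ℚ.≤-refl , ℚ.nonNegative⁻¹ 1ℚ

    τ-averagesInflow : AveragesInflow network τ
    τ-averagesInflow s = in₁ s , in₂ s , incoming s , inflow s
      where
      inflow : ∀ s → τ (tailB (in₁ s)) ℚ.+ τ (tailB (in₂ s)) ≡ τ (spl s) ℚ.+ τ (spl s)
      inflow (Fin.zero , j) = sym (avg+avg≡+ (cI (port₀ j)) (cI (port₁ j)))
      inflow (Fin.suc l , j) = trans (cong (λ k → level k j ℚ.+ level k (cross l j)) (toℕ-inject₁ l))
                                     (sym (avg+avg≡+ (level (toℕ l) j) (level (toℕ l) (cross l j))))

    τ-outArc : ∀ o → τ (tailB (outArc o)) ≡ level (2 * m) (toRow 0)
    τ-outArc o = trans (cong (λ k → level k (half o)) (toℕ-fromℕ (2 * m)))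
                       (level-uniform (≤⇒≤′ (m≤m+n m (m + 0))) (half o) (toRow 0))

  isBalancer : IsBalancer network
  isBalancer cI cO cI∈[0,1] cO≡1 =
    τ cI ∘ tailB , (λ _ → true) ,
    averaging-steadyState network (τ cI) (τ-inUnitInterval cI cI∈[0,1]) (λ _ → refl) cO≡1
                                  (τ-averagesInflow cI) ,
    level cI (2 * m) (toRow 0) , λ where
      (outArc o) _ _ → τ-outArc cI o

proposition3 : (k : ℕ) (hk : 1 ≤ k)
    → IsSplitterNetwork (Benes k hk) × IsBalancer (Benes k hk)
proposition3 (suc m) _ = isSplitterNetwork , isBalancer
  where open BenesNetwork m
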